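{- Let $p\geq 3$ be prime. Then $rb(\mathbb{Z}_p,p)=\frac{p+1}{2}+1$.
   Context: $\mathbb{Z}_n$ denotes the cyclic group of order $n$. An $r$-coloring of $\mathbb{Z}_n$ is a surjective map $c:\mathbb{Z}_n\to\{1,\dots,r\}$. For a fixed integer $k$, a triple is any $(x_1,x_2,x_3)\in\mathbb{Z}_n^3$ with $x_1+x_2\equiv kx_3 \pmod n$. A triple is rainbow under $c$ if $c(x_1),c(x_2),c(x_3)$ are pairwise distinct; $c$ is rainbow-free if no triple is rainbow. The rainbow number $rb(\mathbb{Z}_n,k)$ is the smallest positive integer $r$ such that every $r$-coloring of $\mathbb{Z}_n$ admits a rainbow triple (by convention $rb(\mathbb{Z}_n,k)=n+1$ if no such $r$ exists). -}

module Defs where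

open import Data.Nat using (ℕ; suc; _≤_; _<_)
open import Data.Fin using (Fin; toℕ)
open import Data.Integer as ℤ using (ℤ; +_)
open import Data.Integer.Divisibility as ℤDiv using ()
open import Data.Product using (Σ; ∃; _×_)
open import Data.Sum using (_⊎_)
open import Relation.Binary.PropositionalEquality using (_≡_; _≢_)
open import Relation.Nullary using (¬_)

-- ℤ_n is represented by Fin n (residues 0,…,n-1).
-- (x₁ , x₂ , x₃) is a triple for k iff x₁ + x₂ ≡ k·x₃ (mod n), i.e. n ∣ x₁ + x₂ - k·x₃ in ℤ.
IsTriple : (n : ℕ) (k : ℤ) → Fin n → Fin n → Fin n → Set
IsTriple n k x₁ x₂ x₃ =
  (+ n) ℤDiv.∣ ((+ toℕ x₁ ℤ.+ + toℕ x₂) ℤ.- (k ℤ.* + toℕ x₃))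

-- An r-coloring: a surjective map ℤ_n → {1,…,r} (colors represented by Fin r).
Surjective : ∀ {n r} → (Fin n → Fin r) → Set
Surjective {n} {r} c = (j : Fin r) → ∃ λ i → c i ≡ j

Rainbow : ∀ {n r} → (Fin n → Fin r) → Fin n → Fin n → Fin n → Set
Rainbow c x₁ x₂ x₃ = (c x₁ ≢ c x₂) × (c x₁ ≢ c x₃) × (c x₂ ≢ c x₃)

Forces : (n : ℕ) (k : ℤ) (r : ℕ) → Set
Forces n k r =
  (c : Fin n → Fin r) → Surjective c →
  ∃ λ x₁ → ∃ λ x₂ → ∃ λ x₃ → IsTriple n k x₁ x₂ x₃ × Rainbow c x₁ x₂ x₃

-- rb(ℤ_n , k) = m : m is the smallest positive r with Forces n k r,
-- or (convention) no positive r works and m = n + 1.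
IsRainbowNumber : (n : ℕ) (k : ℤ) (m : ℕ) → Set
IsRainbowNumber n k m =
  (1 ≤ m × Forces n k m × ((r : ℕ) → 1 ≤ r → r < m → ¬ Forces n k r))
  ⊎ (((r : ℕ) → 1 ≤ r → ¬ Forces n k r) × m ≡ suc n)

module Submission where

-- Since k = p ≡ 0 (mod p), a triple is just a pair x₁ + x₂ ≡ 0 together with an
-- arbitrary x₃: a rainbow triple is a pair {x , -x} of two different colors plus
-- any element of a third color.  Primality only enters through oddness, so we
-- work with an arbitrary odd modulus n = 2h + 1 (h ≥ 1) and prove rb(ℤ_n , n) = h + 2.
--
-- With ∣x∣ = min(x , n - x), the coloring x ↦ min(∣x∣ , r - 1)
--    is constant on every pair {x , -x}, hence rainbow-free, and it is surjective
--    as long as r ≤ h + 1 (the values 0,…,h are their own absolute values).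
--  * Upper bound.  Every pair {x , -x} has a representative among 0,…,h.  If a
--    coloring with h + 2 colors were constant on all pairs, the h + 1 residues
--    0,…,h would already hit every color, contradicting pigeonhole.  So some x has
--    c x ≠ c (-x); as h + 2 ≥ 3 a third color exists, giving a rainbow triple.

open import Defs
open import Data.Nat using (ℕ; _≤_; _+_; _/_)
open import Data.Nat.Primality using (Prime)
open import Data.Integer using (+_)

open import Data.Nat using (zero; suc; _<_; _∸_; _⊓_; _*_; z≤n; s≤s; s≤s⁻¹)
open import Data.Nat.Properties
open import Data.Nat.Primality using (composite)
open import Data.Nat.Divisibility using (_∣_; divides)
open import Data.Nat.DivMod using (m*n/n≡m)
open import Data.Fin using (Fin; toℕ; fromℕ<; inject≤)
open import Data.Fin.Patterns using (0F; 1F; 2F)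
open import Data.Fin.Properties using (toℕ-injective; toℕ-fromℕ<; toℕ-inject≤; toℕ<n; ¬∀⟶∃¬; injective⇒≤)
  renaming (_≟_ to _≟ᶠ_)
import Data.Integer as ℤ
import Data.Integer.Divisibility.Signed as ℤ∣
open import Data.Product using (∃; _×_; _,_; proj₁; proj₂)
open import Data.Sum using (_⊎_; inj₁; inj₂)
open import Data.Empty using (⊥; ⊥-elim)
open import Relation.Nullary using (¬_; yes; no)
open import Relation.Nullary.Decidable using (_⊎-dec_)
open import Relation.Binary.PropositionalEquality
open import Function using (_∘_)

-- For k = n the triple condition x₁ + x₂ ≡ n·x₃ (mod n) ignores x₃: it holds
-- exactly when n ∣ x₁ + x₂.  (For naturals, ℤ-divisibility of + m by + n is
-- definitionally n ∣ m.)
triple⇒sum : ∀ {n} (x₁ x₂ x₃ : Fin n) → IsTriple n (+ n) x₁ x₂ x₃ → n ∣ toℕ x₁ + toℕ x₂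
triple⇒sum {n} x₁ x₂ x₃ t =
  ℤ∣.∣⇒∣ᵤ (ℤ∣.∣m+n∣n⇒∣m {+ n} {+ (toℕ x₁ + toℕ x₂)} (ℤ∣.∣ᵤ⇒∣ t) (ℤ∣.∣m⇒∣-m (ℤ∣.∣m⇒∣m*n (+ toℕ x₃) ℤ∣.∣-refl)))

sum⇒triple : ∀ {n} (x₁ x₂ x₃ : Fin n) → n ∣ toℕ x₁ + toℕ x₂ → IsTriple n (+ n) x₁ x₂ x₃
sum⇒triple {n} x₁ x₂ x₃ d =
  ℤ∣.∣⇒∣ᵤ (ℤ∣.∣m∣n⇒∣m-n {+ n} {+ (toℕ x₁ + toℕ x₂)} (ℤ∣.∣ᵤ⇒∣ d) (ℤ∣.∣m⇒∣m*n (+ toℕ x₃) ℤ∣.∣-refl))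

residue-sum : ∀ {n a b} → a < n → b < n → n ∣ a + b → (a ≡ 0 × b ≡ 0) ⊎ a + b ≡ n
residue-sum {a = a} _ _ (divides zero eq) = inj₁ (m+n≡0⇒m≡0 a eq , m+n≡0⇒n≡0 a eq)
residue-sum {n} _ _ (divides (suc zero) eq) = inj₂ (trans eq (+-identityʳ n))
residue-sum {n} {a} {b} a<n b<n (divides (suc (suc q)) eq) = ⊥-elim (<-irrefl refl (begin-strict
    a + b           <⟨ +-mono-< a<n b<n ⟩
    n + n           ≤⟨ +-monoʳ-≤ n (m≤m+n n (q * n)) ⟩
    n + (n + q * n) ≡⟨ sym eq ⟩
    a + b           ∎))
  where open ≤-Reasoning

abs : ℕ → ℕ → ℕ
abs n a = a ⊓ (n ∸ a)

abs-negation : ∀ {n a b} → a < n → b < n → n ∣ a + b → abs n a ≡ abs n b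
abs-negation {n} {a} {b} a<n b<n d with residue-sum a<n b<n d
... | inj₁ (refl , refl) = refl
... | inj₂ a+b≡n = begin
    a ⊓ (n ∸ a)               ≡⟨ cong (λ u → u ⊓ (n ∸ u)) a≡n∸b ⟩
    (n ∸ b) ⊓ (n ∸ (n ∸ b))   ≡⟨ cong ((n ∸ b) ⊓_) (m∸[m∸n]≡n (<⇒≤ b<n)) ⟩
    (n ∸ b) ⊓ b               ≡⟨ ⊓-comm (n ∸ b) b ⟩
    b ⊓ (n ∸ b)               ∎
  where
    open ≡-Reasoning
    a≡n∸b : a ≡ n ∸ b
    a≡n∸b = trans (sym (m+n∸n≡m a b)) (cong (_∸ b) a+b≡n)

abs-lower-half : ∀ {n a} → a + a ≤ n → abs n a ≡ a
abs-lower-half {n} {a} 2a≤n = m≤n⇒m⊓n≡m (m+n≤o⇒m≤o∸n a 2a≤n)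

-- Negation in ℤ_n on the representatives Fin n: 0 ↦ 0 and i + 1 ↦ n - (i + 1).
neg : ∀ {n} → Fin n → Fin n
neg {suc m} Fin.zero    = Fin.zero
neg {suc m} (Fin.suc i) = fromℕ< (s≤s (m∸n≤m m (toℕ i)))

toℕ-neg-suc : ∀ {m} (i : Fin m) → toℕ (neg (Fin.suc i)) ≡ m ∸ toℕ i
toℕ-neg-suc {m} i = toℕ-fromℕ< (s≤s (m∸n≤m m (toℕ i)))

neg-sum : ∀ {n} (x : Fin n) → n ∣ toℕ x + toℕ (neg x)
neg-sum {suc m} Fin.zero    = divides 0 refl
neg-sum {suc m} (Fin.suc i) = divides 1 (begin
    suc (toℕ i + toℕ (neg (Fin.suc i))) ≡⟨ cong (λ u → suc (toℕ i + u)) (toℕ-neg-suc i) ⟩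
    suc (toℕ i + (m ∸ toℕ i))            ≡⟨ cong suc (m+[n∸m]≡n (<⇒≤ (toℕ<n i))) ⟩
    suc m                                ≡⟨ sym (*-identityˡ (suc m)) ⟩
    1 * suc m                            ∎)
  where open ≡-Reasoning

-- Pigeonhole for surjections: a surjection Fin m → Fin n forces n ≤ m, since
-- choosing preimages gives an injection Fin n → Fin m.
surjection⇒≤ : ∀ {m n} (g : Fin m → Fin n) → Surjective g → n ≤ m
surjection⇒≤ {m} {n} g surj = injective⇒≤ {f = section} section-injective
  where
    section : Fin n → Fin m
    section j = proj₁ (surj j)
    section-injective : ∀ {a b} → section a ≡ section b → a ≡ b
    section-injective {a} {b} e = trans (sym (proj₂ (surj a))) (trans (cong g e) (proj₂ (surj b)))

two-cover-three : ∀ {k} (a b : Fin (3 + k)) →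
  a ≡ 0F ⊎ b ≡ 0F → a ≡ 1F ⊎ b ≡ 1F → a ≡ 2F ⊎ b ≡ 2F → ⊥
two-cover-three _ _ (inj₁ refl) (inj₂ refl) (inj₁ ())
two-cover-three _ _ (inj₁ refl) (inj₂ refl) (inj₂ ())
two-cover-three _ _ (inj₂ refl) (inj₁ refl) (inj₁ ())
two-cover-three _ _ (inj₂ refl) (inj₁ refl) (inj₂ ())

third-color : ∀ {m} → 3 ≤ m → (a b : Fin m) → ∃ λ j → a ≢ j × b ≢ j
third-color (s≤s (s≤s (s≤s _))) a b
  with j , j∉ ← ¬∀⟶∃¬ _ (λ j → a ≡ j ⊎ b ≡ j) (λ j → (a ≟ᶠ j) ⊎-dec (b ≟ᶠ j))
                        (λ hit → two-cover-three a b (hit 0F) (hit 1F) (hit 2F))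
  = j , (λ e → j∉ (inj₁ e)) , (λ e → j∉ (inj₂ e))

module OddModulus (h : ℕ) where

  n : ℕ
  n = suc (h + h)

  lower-half-member : (x : Fin n) → toℕ x ≤ h ⊎ toℕ (neg x) ≤ h
  lower-half-member Fin.zero = inj₁ z≤n
  lower-half-member (Fin.suc i) with suc (toℕ i) ≤? h
  ... | yes i<h = inj₁ i<h
  ... | no  i≮h = inj₂ (begin
      toℕ (neg (Fin.suc i)) ≡⟨ toℕ-neg-suc i ⟩
      (h + h) ∸ toℕ i        ≤⟨ ∸-monoʳ-≤ (h + h) (s≤s⁻¹ (≰⇒> i≮h)) ⟩
      (h + h) ∸ h            ≡⟨ m+n∸n≡m h h ⟩
      h                      ∎)
    where open ≤-Reasoning

  lower-half : Fin (suc h) → Fin n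
  lower-half i = inject≤ i (s≤s (m≤m+n h h))

  lower-half-onto : (y : Fin n) → toℕ y ≤ h → ∃ λ i → lower-half i ≡ y
  lower-half-onto y y≤h = fromℕ< (s≤s y≤h) , toℕ-injective (begin
      toℕ (lower-half (fromℕ< (s≤s y≤h))) ≡⟨ toℕ-inject≤ _ _ ⟩
      toℕ (fromℕ< (s≤s y≤h))              ≡⟨ toℕ-fromℕ< (s≤s y≤h) ⟩
      toℕ y                                ∎)
    where open ≡-Reasoning

  truncated-abs : (r : ℕ) → Fin n → Fin (suc r)
  truncated-abs r x = fromℕ< (s≤s (m⊓n≤n (abs n (toℕ x)) r))

  toℕ-truncated-abs : ∀ r x → toℕ (truncated-abs r x) ≡ abs n (toℕ x) ⊓ r
  toℕ-truncated-abs r x = toℕ-fromℕ< (s≤s (m⊓n≤n (abs n (toℕ x)) r))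

  -- It uses all r + 1 colors as long as r ≤ h: the color j is taken by j itself.
  truncated-abs-surjective : ∀ {r} → r ≤ h → Surjective (truncated-abs r)
  truncated-abs-surjective {r} r≤h j = y , toℕ-injective (begin
      toℕ (truncated-abs r y)   ≡⟨ toℕ-truncated-abs r y ⟩
      abs n (toℕ y) ⊓ r         ≡⟨ cong (λ u → abs n u ⊓ r) (toℕ-fromℕ< j<n) ⟩
      abs n (toℕ j) ⊓ r         ≡⟨ cong (_⊓ r) (abs-lower-half 2j≤n) ⟩
      toℕ j ⊓ r                 ≡⟨ m≤n⇒m⊓n≡m j≤r ⟩
      toℕ j                     ∎)
    where
      open ≡-Reasoning
      j≤r : toℕ j ≤ r
      j≤r = s≤s⁻¹ (toℕ<n j)
      j≤h : toℕ j ≤ h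
      j≤h = ≤-trans j≤r r≤h
      j<n : toℕ j < n
      j<n = s≤s (≤-trans j≤h (m≤m+n h h))
      2j≤n : toℕ j + toℕ j ≤ n
      2j≤n = ≤-trans (+-mono-≤ j≤h j≤h) (n≤1+n (h + h))
      y : Fin n
      y = fromℕ< j<n

  truncated-abs-triple : ∀ r x₁ x₂ x₃ → IsTriple n (+ n) x₁ x₂ x₃ →
                         truncated-abs r x₁ ≡ truncated-abs r x₂
  truncated-abs-triple r x₁ x₂ x₃ t = toℕ-injective (begin
      toℕ (truncated-abs r x₁)  ≡⟨ toℕ-truncated-abs r x₁ ⟩
      abs n (toℕ x₁) ⊓ r        ≡⟨ cong (_⊓ r) (abs-negation (toℕ<n x₁) (toℕ<n x₂) (triple⇒sum x₁ x₂ x₃ t)) ⟩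
      abs n (toℕ x₂) ⊓ r        ≡⟨ sym (toℕ-truncated-abs r x₂) ⟩
      toℕ (truncated-abs r x₂)  ∎)
    where open ≡-Reasoning

  no-rainbow-below : ∀ {r} → r ≤ h → ¬ Forces n (+ n) (suc r)
  no-rainbow-below {r} r≤h forces
    with x₁ , x₂ , x₃ , t , (c₁≢c₂ , _) ← forces (truncated-abs r) (truncated-abs-surjective r≤h)
    = c₁≢c₂ (truncated-abs-triple r x₁ x₂ x₃ t)

  -- Upper bound: a surjective coloring with h + 2 colors separates some pair
  -- {x , -x}, since otherwise the h + 1 lower-half residues would see every color.
  separated-pair : (c : Fin n → Fin (2 + h)) → Surjective c → ∃ λ x → c x ≢ c (neg x)
  separated-pair c surj =
    ¬∀⟶∃¬ n (λ x → c x ≡ c (neg x)) (λ x → c x ≟ᶠ c (neg x)) not-symmetric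
    where
      not-symmetric : ¬ (∀ x → c x ≡ c (neg x))
      not-symmetric symmetric = 1+n≰n (surjection⇒≤ (c ∘ lower-half) onto)
        where
          onto : Surjective (c ∘ lower-half)
          onto j with x , cx≡j ← surj j | lower-half-member x
          ... | inj₁ x≤h  with i , eq ← lower-half-onto x x≤h = i , trans (cong c eq) cx≡j
          ... | inj₂ -x≤h with i , eq ← lower-half-onto (neg x) -x≤h =
                i , trans (cong c eq) (trans (sym (symmetric x)) cx≡j)

  rainbow-at : 1 ≤ h → Forces n (+ n) (2 + h)
  rainbow-at 1≤h c surj
    with x , c-separates ← separated-pair c surj
    with j , cx≢j , c-x≢j ← third-color (s≤s (s≤s 1≤h)) (c x) (c (neg x))
    with x₃ , cx₃≡j ← surj j
    = x , neg x , x₃ , sum⇒triple x (neg x) x₃ (neg-sum x)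
    , c-separates , (λ e → cx≢j (trans e cx₃≡j)) , (λ e → c-x≢j (trans e cx₃≡j))

  rainbow-number : 1 ≤ h → IsRainbowNumber n (+ n) (2 + h)
  rainbow-number 1≤h = inj₁ (s≤s z≤n , rainbow-at 1≤h , fewer-colors)
    where
      fewer-colors : (r : ℕ) → 1 ≤ r → r < 2 + h → ¬ Forces n (+ n) r
      fewer-colors (suc r) _ r<1+h = no-rainbow-below (s≤s⁻¹ (s≤s⁻¹ r<1+h))

even-or-odd : ∀ m → (∃ λ h → m ≡ h + h) ⊎ (∃ λ h → m ≡ suc (h + h))
even-or-odd zero = inj₁ (0 , refl)
even-or-odd (suc m) with even-or-odd m
... | inj₁ (h , m≡2h)   = inj₂ (h , cong suc m≡2h)
... | inj₂ (h , m≡2h+1) = inj₁ (suc h , trans (cong suc m≡2h+1) (cong suc (sym (+-suc h h))))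

-- A prime p ≥ 3 is odd, p = 2h + 1 with h ≥ 1: otherwise 2 would be a proper divisor.
odd-prime : ∀ {p} → Prime p → 3 ≤ p → ∃ λ h → 1 ≤ h × p ≡ suc (h + h)
odd-prime {p} p-prime 3≤p with even-or-odd p
... | inj₁ (h , refl)      = ⊥-elim (Prime.notComposite p-prime (composite 3≤p (divides h 2h≡h*2)))
  where
    2h≡h*2 : h + h ≡ h * 2
    2h≡h*2 = trans (cong (λ u → h + u) (sym (+-identityʳ h))) (*-comm 2 h)
... | inj₂ (zero , refl)   = ⊥-elim (≤⇒≯ 3≤p (s≤s (s≤s z≤n)))
... | inj₂ (suc h , refl)  = suc h , s≤s z≤n , refl

claimed-value : ∀ h → (suc (h + h) + 1) / 2 + 1 ≡ 2 + h
claimed-value h = begin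
    (suc (h + h) + 1) / 2 + 1 ≡⟨ cong (λ u → u / 2 + 1) p+1≡[h+1]*2 ⟩
    suc h * 2 / 2 + 1         ≡⟨ cong (_+ 1) (m*n/n≡m (suc h) 2) ⟩
    suc h + 1                 ≡⟨ +-comm (suc h) 1 ⟩
    2 + h                     ∎
  where
    open ≡-Reasoning
    p+1≡[h+1]*2 : suc (h + h) + 1 ≡ suc h * 2
    p+1≡[h+1]*2 = begin
      suc (h + h) + 1     ≡⟨ +-comm (suc (h + h)) 1 ⟩
      suc (suc h + h)     ≡⟨ cong suc (sym (+-suc h h)) ⟩
      suc h + suc h       ≡⟨ cong (λ u → suc h + u) (sym (+-identityʳ (suc h))) ⟩
      2 * suc h           ≡⟨ *-comm 2 (suc h) ⟩
      suc h * 2           ∎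

proposition4 : (p : ℕ) → Prime p → 3 ≤ p →
    IsRainbowNumber p (+ p) ((p + 1) / 2 + 1)
proposition4 p p-prime 3≤p with odd-prime p-prime 3≤p
... | h , 1≤h , refl =
  subst (IsRainbowNumber p (+ p)) (sym (claimed-value h)) (OddModulus.rainbow-number h 1≤h)
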